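{- Let $(A,\mu)$ be a state-morphism pseudo BCK-algebra with $A$ commutative. Then: (1) ${\rm Im}(\mu)$ is a commutative pseudo BCK-algebra (as a subalgebra of $A$); (2) $\mu(x\vee y)=\mu(x)\vee\mu(y)$ and $\mu(\mu(x)\vee\mu(y))=\mu(x)\vee\mu(y)$ for all $x,y\in A$.
   Context: A pseudo BCK-algebra is an algebra $(A,\rightarrow,\rightsquigarrow,1)$ of type $(2,2,0)$ such that for all $x,y,z\in A$: $(x\rightarrow y)\rightsquigarrow[(y\rightarrow z)\rightsquigarrow(x\rightarrow z)]=1$; $(x\rightsquigarrow y)\rightarrow[(y\rightsquigarrow z)\rightarrow(x\rightsquigarrow z)]=1$; $1\rightarrow x=x$; $1\rightsquigarrow x=x$; $x\rightarrow 1=1$; and if $x\rightarrow y=1$ and $y\rightarrow x=1$ then $x=y$. The order is $x\le y$ iff $x\rightarrow y=1$. $A$ is commutative if $(x\rightarrow y)\rightsquigarrow y=(y\rightarrow x)\rightsquigarrow x$ and $(x\rightsquigarrow y)\rightarrow y=(y\rightsquigarrow x)\rightarrow x$ for all $x,y$; in that case $(A,\le)$ is a join-semilattice with $x\vee y=(x\rightarrow y)\rightsquigarrow y=(x\rightsquigarrow y)\rightarrow y$. A state-morphism operator on $A$ is a homomorphism $\mu:A\to A$ (preserving $\rightarrow$, $\rightsquigarrow$ and $1$) with $\mu\circ\mu=\mu$; $(A,\mu)$ is then a state-morphism pseudo BCK-algebra. -}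

module Defs where

open import Level using (Level; suc; _⊔_)
open import Data.Product using (_×_; ∃)
open import Relation.Binary.PropositionalEquality using (_≡_)

record PseudoBCK (a : Level) : Set (suc a) where
  infixr 5 _⇒_ _⇝_
  field
    Carrier : Set a
    _⇒_     : Carrier → Carrier → Carrier
    _⇝_     : Carrier → Carrier → Carrier
    𝟙       : Carrier
    ax1 : ∀ x y z → (x ⇒ y) ⇝ ((y ⇒ z) ⇝ (x ⇒ z)) ≡ 𝟙
    ax2 : ∀ x y z → (x ⇝ y) ⇒ ((y ⇝ z) ⇒ (x ⇝ z)) ≡ 𝟙
    ax3 : ∀ x → 𝟙 ⇒ x ≡ x
    ax4 : ∀ x → 𝟙 ⇝ x ≡ x
    ax5 : ∀ x → x ⇒ 𝟙 ≡ 𝟙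
    ax6 : ∀ x y → x ⇒ y ≡ 𝟙 → y ⇒ x ≡ 𝟙 → x ≡ y

  _≤_ : Carrier → Carrier → Set a
  x ≤ y = x ⇒ y ≡ 𝟙

  -- join in the commutative case: x ∨ y = (x → y) ⇝ y
  _∨_ : Carrier → Carrier → Carrier
  x ∨ y = (x ⇒ y) ⇝ y

  IsSubalgebra : ∀ {p} → (Carrier → Set p) → Set (a ⊔ p)
  IsSubalgebra P = P 𝟙 × (∀ {x y} → P x → P y → P (x ⇒ y))
                       × (∀ {x y} → P x → P y → P (x ⇝ y))

  IsPseudoBCKOn : ∀ {p} → (Carrier → Set p) → Set (a ⊔ p)
  IsPseudoBCKOn P =
    (∀ {x y z} → P x → P y → P z → (x ⇒ y) ⇝ ((y ⇒ z) ⇝ (x ⇒ z)) ≡ 𝟙)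
    × (∀ {x y z} → P x → P y → P z → (x ⇝ y) ⇒ ((y ⇝ z) ⇒ (x ⇝ z)) ≡ 𝟙)
    × (∀ {x} → P x → 𝟙 ⇒ x ≡ x)
    × (∀ {x} → P x → 𝟙 ⇝ x ≡ x)
    × (∀ {x} → P x → x ⇒ 𝟙 ≡ 𝟙)
    × (∀ {x y} → P x → P y → x ⇒ y ≡ 𝟙 → y ⇒ x ≡ 𝟙 → x ≡ y)

  CommutativeOn : ∀ {p} → (Carrier → Set p) → Set (a ⊔ p)
  CommutativeOn P = ∀ {x y} → P x → P y →
    ((x ⇒ y) ⇝ y ≡ (y ⇒ x) ⇝ x) × ((x ⇝ y) ⇒ y ≡ (y ⇝ x) ⇒ x)

  Commutative : Set a
  Commutative = ∀ x y →
    ((x ⇒ y) ⇝ y ≡ (y ⇒ x) ⇝ x) × ((x ⇝ y) ⇒ y ≡ (y ⇝ x) ⇒ x)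

  record IsStateMorphism (μ : Carrier → Carrier) : Set a where
    field
      pres-⇒ : ∀ x y → μ (x ⇒ y) ≡ μ x ⇒ μ y
      pres-⇝ : ∀ x y → μ (x ⇝ y) ≡ μ x ⇝ μ y
      pres-𝟙 : μ 𝟙 ≡ 𝟙
      idem   : ∀ x → μ (μ x) ≡ μ x

  Im : (Carrier → Carrier) → Carrier → Set a
  Im μ a = ∃ λ b → μ b ≡ a

module Submission where

open import Defs
open import Level using (Level)
open import Data.Product using (_×_; _,_)
open import Relation.Binary.PropositionalEquality using (_≡_; refl; cong₂; module ≡-Reasoning)

module _ {a : Level} (A : PseudoBCK a) where
  open PseudoBCK A

  -- The axioms are universal equations on A, so they restrict to any subset;
  -- for Im μ all the content of part (1) is closure under the operations.
  isPseudoBCKOn : ∀ {p} (P : Carrier → Set p) → IsPseudoBCKOn P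
  isPseudoBCKOn P =
    (λ _ _ _ → ax1 _ _ _) , (λ _ _ _ → ax2 _ _ _) , (λ _ → ax3 _) , (λ _ → ax4 _)
    , (λ _ → ax5 _) , (λ _ _ → ax6 _ _)

  commutative⇒commutativeOn : Commutative → ∀ {p} (P : Carrier → Set p) → CommutativeOn P
  commutative⇒commutativeOn comm P {x} {y} _ _ = comm x y

  module _ {μ : Carrier → Carrier} (sm : IsStateMorphism μ) where
    open IsStateMorphism sm

    Im-isSubalgebra : IsSubalgebra (Im μ)
    Im-isSubalgebra =
      (𝟙 , pres-𝟙)
      , (λ { (b , refl) (c , refl) → b ⇒ c , pres-⇒ b c })
      , (λ { (b , refl) (c , refl) → b ⇝ c , pres-⇝ b c })

    μ-∨ : ∀ x y → μ (x ∨ y) ≡ μ x ∨ μ y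
    μ-∨ x y = begin
      μ ((x ⇒ y) ⇝ y)     ≡⟨ pres-⇝ (x ⇒ y) y ⟩
      μ (x ⇒ y) ⇝ μ y     ≡⟨ cong₂ _⇝_ (pres-⇒ x y) refl ⟩
      (μ x ⇒ μ y) ⇝ μ y   ∎
      where open ≡-Reasoning

    μ-∨-μ : ∀ x y → μ (μ x ∨ μ y) ≡ μ x ∨ μ y
    μ-∨-μ x y = begin
      μ (μ x ∨ μ y)         ≡⟨ μ-∨ (μ x) (μ y) ⟩
      μ (μ x) ∨ μ (μ y)     ≡⟨ cong₂ _∨_ (idem x) (idem y) ⟩
      μ x ∨ μ y             ∎
      where open ≡-Reasoning

proposition6p8 : ∀ {a : Level} (A : PseudoBCK a) (μ : PseudoBCK.Carrier A → PseudoBCK.Carrier A)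
    → PseudoBCK.IsStateMorphism A μ
    → PseudoBCK.Commutative A
    → (PseudoBCK.IsSubalgebra A (PseudoBCK.Im A μ)
    × PseudoBCK.IsPseudoBCKOn A (PseudoBCK.Im A μ)
    × PseudoBCK.CommutativeOn A (PseudoBCK.Im A μ))
    × (∀ x y → μ (PseudoBCK._∨_ A x y) ≡ PseudoBCK._∨_ A (μ x) (μ y)
    × μ (PseudoBCK._∨_ A (μ x) (μ y)) ≡ PseudoBCK._∨_ A (μ x) (μ y))
proposition6p8 A μ sm comm =
  ( Im-isSubalgebra A sm
  , isPseudoBCKOn A (PseudoBCK.Im A μ)
  , commutative⇒commutativeOn A comm (PseudoBCK.Im A μ))
  , λ x y → μ-∨ A sm x y , μ-∨-μ A sm x y
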